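{- Let $p_1=2, p_2=3, p_3=5,\dots$ denote the prime numbers in increasing order, let $\mathbb{P}=\{p_1,p_2,p_3,\dots\}$, and for a set $J$ of positive integers write $\mathbb{P}_J=\{p_n \mid n\in J\}$. Then there is a unique subset $I\subseteq\mathbb{P}$ such that \[ \mathbb{P}=I\cup\mathbb{P}_I \quad\text{and}\quad I\cap\mathbb{P}_I=\emptyset . \]
   Context: $p_n$ denotes the $n$-th prime. For $J\subseteq\mathbb{P}$, $\mathbb{P}_J=\{p_n\mid n\in J\}$; the indices refer to positions in the full sequence of primes, not to positions within $J$. -}

module Defs where

open import Level using (0ℓ)
open import Data.Nat using (ℕ; zero; suc)
open import Data.Nat.Primality using (Prime; prime?)
open import Data.Product using (Σ; _×_)
open import Relation.Nullary using (yes; no)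
open import Relation.Binary.PropositionalEquality using (_≡_)
open import Relation.Unary using (Pred)

primeCount : ℕ → ℕ
primeCount zero = 0
primeCount (suc x) with prime? (suc x)
... | yes _ = suc (primeCount x)
... | no _  = primeCount x

-- IsNthPrime n q  :  q = p_n, the n-th prime (p_1 = 2, p_2 = 3, ...),
-- i.e. q is prime and exactly n primes are ≤ q.
IsNthPrime : ℕ → ℕ → Set
IsNthPrime n q = Prime q × primeCount q ≡ n

ℙ : Pred ℕ 0ℓ
ℙ = Prime

ℙ[_] : Pred ℕ 0ℓ → Pred ℕ 0ℓ
ℙ[ J ] q = Σ ℕ (λ n → J n × IsNthPrime n q)

{-# OPTIONS --safe #-}
-- For a prime q we have p_{π(q)} = q, so the two conditions say exactly that a
-- prime q lies in I iff π(q) does not, while no non-prime lies in I.  Since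
-- π(q) < q, this determines I by strong induction: q ∈ I iff the chain
-- q, π(q), π(π(q)), … starts with an odd number of primes.
module Submission where

open import Defs
open import Level using (0ℓ)
open import Data.Nat using (ℕ; zero; suc; _≤_; _<_; z≤n; s≤s; s≤s⁻¹)
open import Data.Nat.Properties using (≤-refl; m≤n⇒m≤1+n; <-≤-trans)
open import Data.Nat.Primality using (Prime; prime?; ¬prime[0]; ¬prime[1])
open import Data.Nat.Induction using (<-rec)
open import Data.Bool using (Bool; true; false; not; T; T?)
open import Data.Product using (Σ; _×_; _,_; proj₁; proj₂)
open import Data.Sum using (inj₁; inj₂)
open import Data.Empty using (⊥-elim)
open import Function using (_⇔_; mk⇔; Equivalence)
open import Relation.Nullary using (yes; no; ¬_)
open import Relation.Binary.PropositionalEquality using (_≡_; refl; cong; subst; sym; trans)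
open import Relation.Unary using (Pred; Decidable; _⊆_; _∪_; _∩_; _≐_; Empty)

open Equivalence using (to; from)

primeCount-suc≤ : ∀ x → primeCount (suc x) ≤ x
primeCount-suc≤ zero with prime? 1
... | yes p = ⊥-elim (¬prime[1] p)
... | no _  = z≤n
primeCount-suc≤ (suc x) with prime? (suc (suc x))
... | yes _ = s≤s (primeCount-suc≤ x)
... | no _  = m≤n⇒m≤1+n (primeCount-suc≤ x)

primeCount<prime : ∀ {q} → Prime q → primeCount q < q
primeCount<prime {zero}  p = ⊥-elim (¬prime[0] p)
primeCount<prime {suc x} _ = s≤s (primeCount-suc≤ x)

∈ℙ[]⇔ : ∀ {J : Pred ℕ 0ℓ} {q} → ℙ[ J ] q ⇔ (Prime q × J (primeCount q))
∈ℙ[]⇔ {J} = mk⇔ (λ { (_ , Jn , p , πq≡n) → p , subst J (sym πq≡n) Jn })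
                (λ { (p , Jπq) → _ , Jπq , p , refl })

Alternating : Pred ℕ 0ℓ → Set
Alternating J = ∀ {q} → Prime q → J q ⇔ (¬ J (primeCount q))

partition⇒alternating : ∀ {J} → ℙ ⊆ J ∪ ℙ[ J ] → Empty (J ∩ ℙ[ J ]) → Alternating J
partition⇒alternating {J} cover disjoint {q} p = mk⇔ outside inside
  where
  outside : J q → ¬ J (primeCount q)
  outside Jq Jπq = disjoint q (Jq , from ∈ℙ[]⇔ (p , Jπq))

  inside : ¬ J (primeCount q) → J q
  inside ¬Jπq with cover p
  ... | inj₁ Jq  = Jq
  ... | inj₂ Jpq = ⊥-elim (¬Jπq (proj₂ (to ∈ℙ[]⇔ Jpq)))

alternating⇒partition : ∀ {J} → Decidable J → J ⊆ ℙ → Alternating J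
                      → ℙ ≐ J ∪ ℙ[ J ] × Empty (J ∩ ℙ[ J ])
alternating⇒partition {J} J? J⊆ℙ alt = (cover , covered) , disjoint
  where
  cover : ℙ ⊆ J ∪ ℙ[ J ]
  cover {q} p with J? q | J? (primeCount q)
  ... | yes Jq | _        = inj₁ Jq
  ... | no _   | yes Jπq  = inj₂ (from ∈ℙ[]⇔ (p , Jπq))
  ... | no ¬Jq | no ¬Jπq  = ⊥-elim (¬Jq (from (alt p) ¬Jπq))

  covered : J ∪ ℙ[ J ] ⊆ ℙ
  covered (inj₁ Jq)  = J⊆ℙ Jq
  covered (inj₂ Jpq) = proj₁ (to ∈ℙ[]⇔ Jpq)

  disjoint : Empty (J ∩ ℙ[ J ])
  disjoint q (Jq , Jpq) with to ∈ℙ[]⇔ Jpq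
  ... | p , Jπq = to (alt p) Jq Jπq

alternating-unique : ∀ {J K} → J ⊆ ℙ → K ⊆ ℙ → Alternating J → Alternating K → J ≐ K
alternating-unique {J} {K} J⊆ℙ K⊆ℙ altJ altK =
  (λ {q} → to (agree q)) , (λ {q} → from (agree q))
  where
  transfer : ∀ {A B : Pred ℕ 0ℓ} {q} → Prime q → Alternating A → Alternating B
           → (B (primeCount q) → A (primeCount q)) → A q → B q
  transfer p altA altB Bπ⇒Aπ Aq = from (altB p) (λ Bπq → to (altA p) Aq (Bπ⇒Aπ Bπq))

  agree : ∀ q → J q ⇔ K q
  agree = <-rec _ λ q ih →
    mk⇔ (λ Jq → let p = J⊆ℙ Jq in transfer p altJ altK (from (ih (primeCount<prime p))) Jq)
        (λ Kq → let p = K⊆ℙ Kq in transfer p altK altJ (to   (ih (primeCount<prime p))) Kq)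

-- The fuel k bounds the recursion depth; fuel q suffices because π(q) < q.
indicatorWithin : ℕ → ℕ → Bool
indicatorWithin zero    q = false
indicatorWithin (suc k) q with prime? q
... | yes _ = not (indicatorWithin k (primeCount q))
... | no _  = false

indicatorWithin-stable : ∀ {k k′ q} → q ≤ k → q ≤ k′ → indicatorWithin k q ≡ indicatorWithin k′ q
indicatorWithin-stable {zero}  {zero}     _   _    = refl
indicatorWithin-stable {zero}  {suc _}    z≤n _    = refl
indicatorWithin-stable {suc _} {zero}     _   z≤n  = refl
indicatorWithin-stable {suc k} {suc k′} {q} q≤k q≤k′ with prime? q
... | yes p = cong not (indicatorWithin-stable (πq≤ q≤k) (πq≤ q≤k′))
  where
  πq≤ : ∀ {m} → q ≤ suc m → primeCount q ≤ m
  πq≤ q≤1+m = s≤s⁻¹ (<-≤-trans (primeCount<prime p) q≤1+m)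
... | no _  = refl

indicatorWithin-prime : ∀ {k q} → Prime q
                     → indicatorWithin (suc k) q ≡ not (indicatorWithin k (primeCount q))
indicatorWithin-prime {q = q} p with prime? q
... | yes _ = refl
... | no ¬p = ⊥-elim (¬p p)

indicator : ℕ → Bool
indicator q = indicatorWithin q q

indicator-prime : ∀ {q} → Prime q → indicator q ≡ not (indicator (primeCount q))
indicator-prime {zero}  p = ⊥-elim (¬prime[0] p)
indicator-prime {suc x} p = trans (indicatorWithin-prime p)
  (cong not (indicatorWithin-stable (primeCount-suc≤ x) ≤-refl))

indicator-nonprime : ∀ {q} → ¬ Prime q → indicator q ≡ false
indicator-nonprime {zero}  _  = refl
indicator-nonprime {suc x} ¬p with prime? (suc x)
... | yes p = ⊥-elim (¬p p)
... | no _  = refl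

T-not⇔¬T : ∀ {b} → T (not b) ⇔ (¬ T b)
T-not⇔¬T {true}  = mk⇔ (λ ()) (λ ¬⊤ → ¬⊤ _)
T-not⇔¬T {false} = mk⇔ (λ _ ()) (λ _ → _)

I : Pred ℕ 0ℓ
I q = T (indicator q)

I⊆ℙ : I ⊆ ℙ
I⊆ℙ {q} Iq with prime? q
... | yes p = p
... | no ¬p = ⊥-elim (subst T (indicator-nonprime ¬p) Iq)

I-alternating : Alternating I
I-alternating {q} p = subst (λ b → T b ⇔ (¬ I (primeCount q))) (sym (indicator-prime p)) T-not⇔¬T

theorem1p1 : Σ (Pred ℕ 0ℓ) (λ I → (I ⊆ ℙ × ℙ ≐ I ∪ ℙ[ I ] × Empty (I ∩ ℙ[ I ]))
    × ((J : Pred ℕ 0ℓ) → J ⊆ ℙ → ℙ ≐ J ∪ ℙ[ J ] → Empty (J ∩ ℙ[ J ]) → J ≐ I))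
theorem1p1 =
  I , (I⊆ℙ , alternating⇒partition (λ q → T? (indicator q)) I⊆ℙ I-alternating) ,
  λ J J⊆ℙ (cover , _) disjoint →
    alternating-unique J⊆ℙ I⊆ℙ (partition⇒alternating cover disjoint) I-alternating
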